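{- Let $n\ge1$, let $A$ be an antichain of $\mathsf{A}^n$ and $p\in\mathsf{A}^n$. (1) If $p=[i,i]$ is minimal, then $p\in\mathrm{LK}(A)$ if and only if $p\in\boldsymbol{\tau}_0(A)$, i.e., if and only if $A$ contains no element $q\ge p$. (2) If $p=[i,j]$ with $j>i$ (so $n\ge2$), then $p\in\mathrm{LK}(A)$ if and only if $[i,j-1]\in\mathrm{row}_{\mathcal{A}}^{ -1}(\mathrm{LK}(\overline{A}))$, where $\overline{A}=\{[a,b-1]:[a,b]\in A,\ b>a\}$ is an antichain of $\mathsf{A}^{n-1}$, and $\mathrm{LK}$ and $\mathrm{row}_{\mathcal{A}}$ on the right-hand side are those of $\mathsf{A}^{n-1}$.
   Context: $\mathsf{A}^n$ is the poset of intervals $[i,j]=\{i,\dots,j\}$, $1\le i\le j\le n$, ordered by inclusion; it is graded with $\mathrm{rk}([i,j])=j-i$. The map $[i,j]\mapsto[i,j-1]$ identifies the subposet of non-minimal elements of $\mathsf{A}^n$ with $\mathsf{A}^{n-1}$. An antichain $A=\{[i_1,j_1],\dots,[i_k,j_k]\}$ with $i_1<\dots<i_k$ has $j_1<\dots<j_k$; the Lalanne--Kreweras involution is $\mathrm{LK}(A)=\{[i'_1,j'_1],\dots,[i'_m,j'_m]\}$ where $\{i'_1<\dots<i'_m\}=\{1,\dots,n\}\setminus\{j_1,\dots,j_k\}$, $\{j'_1<\dots<j'_m\}=\{1,\dots,n\}\setminus\{i_1,\dots,i_k\}$. Antichain toggle: $\tau_p(A)=A\cup\{p\}$ if $p\notin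 A$ and $A\cup\{p\}$ is an antichain, $A\setminus\{p\}$ if $p\in A$, else $A$; $\boldsymbol{\tau}_0=\prod_{p\text{ minimal}}\tau_p$. Antichain rowmotion: $\mathrm{row}_{\mathcal{A}}(A)$ is the set of minimal elements of $\{x: x\not\le y\text{ for all }y\in A\}$ (a bijection on antichains). -}

module Defs where

open import Data.Nat using (ℕ; zero; suc; _≤_; _∸_; _≤ᵇ_; _≡ᵇ_)
open import Data.Bool using (Bool; true; false; _∧_; _∨_; not; if_then_else_)
open import Data.Product using (_×_; _,_; Σ)
open import Data.List using (List; map; upTo; filterᵇ; zip; concatMap; foldr)
open import Data.Bool.ListAction using (any; all)
open import Relation.Binary.PropositionalEquality using (_≡_)

-- Elements of the poset A^n are intervals [i,j] with 1 ≤ i ≤ j ≤ n,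
-- encoded as pairs (i , j) of natural numbers.
Valid : ℕ → ℕ → ℕ → Set
Valid n i j = (1 ≤ i) × (i ≤ j) × (j ≤ n)

validᵇ : ℕ → ℕ → ℕ → Bool
validᵇ n i j = (1 ≤ᵇ i) ∧ ((i ≤ᵇ j) ∧ (j ≤ᵇ n))

range : ℕ → List ℕ
range n = map suc (upTo n)

elements : ℕ → List (ℕ × ℕ)
elements n = concatMap (λ i → map (λ j → (i , j)) (filterᵇ (λ j → i ≤ᵇ j) (range n))) (range n)

leᵇ : ℕ × ℕ → ℕ × ℕ → Bool
leᵇ (i , j) (k , l) = (k ≤ᵇ i) ∧ (j ≤ᵇ l)

eqᵇ : ℕ × ℕ → ℕ × ℕ → Bool
eqᵇ (i , j) (k , l) = (i ≡ᵇ k) ∧ (j ≡ᵇ l)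

ASet : Set
ASet = ℕ → ℕ → Bool

_∈ˢ_ : ℕ × ℕ → ASet → Set
(i , j) ∈ˢ A = A i j ≡ true

IsAntichain : ℕ → ASet → Set
IsAntichain n A =
  ((i j : ℕ) → A i j ≡ true → Valid n i j) ×
  ((i j k l : ℕ) → A i j ≡ true → A k l ≡ true → k ≤ i → j ≤ l → (i ≡ k) × (j ≡ l))

isLeftᵇ : ℕ → ASet → ℕ → Bool
isLeftᵇ n A i = any (λ j → A i j) (range n)

isRightᵇ : ℕ → ASet → ℕ → Bool
isRightᵇ n A j = any (λ i → A i j) (range n)

LK : ℕ → ASet → ASet
LK n A i j = any (λ q → eqᵇ q (i , j))
  (zip (filterᵇ (λ x → not (isRightᵇ n A x)) (range n))
       (filterᵇ (λ y → not (isLeftᵇ n A y)) (range n)))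

-- Antichain toggle τ_p on antichains of A^n
-- (for an antichain A and p ∉ A, A ∪ {p} is an antichain iff p is an
--  element of A^n comparable to no element of A)
comparableInᵇ : ℕ → ASet → ℕ × ℕ → Bool
comparableInᵇ n A p =
  any (λ q → A (Data.Product.proj₁ q) (Data.Product.proj₂ q) ∧ (leᵇ p q ∨ leᵇ q p)) (elements n)

toggle : ℕ → ℕ × ℕ → ASet → ASet
toggle n (i , j) A k l =
  if eqᵇ (k , l) (i , j)
  then (if A i j then false else (validᵇ n i j ∧ not (comparableInᵇ n A (i , j))))
  else A k l

tau0 : ℕ → ASet → ASet
tau0 n A = foldr (λ i B → toggle n (i , i) B) A (range n)

notBelowᵇ : ℕ → ASet → ℕ × ℕ → Bool
notBelowᵇ n A x =
  all (λ y → not (A (Data.Product.proj₁ y) (Data.Product.proj₂ y) ∧ leᵇ x y)) (elements n)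

rowA : ℕ → ASet → ASet
rowA n A i j =
  validᵇ n i j ∧ notBelowᵇ n A (i , j) ∧
  not (any (λ y → leᵇ y (i , j) ∧ not (eqᵇ y (i , j)) ∧ notBelowᵇ n A y) (elements n))

bar : ASet → ASet
bar A a c = A a (suc c) ∧ (a ≤ᵇ c)

{-# OPTIONS --safe #-}
module Submission where

-- LK(A) pairs the k-th element of [1, n] that is not a right endpoint of an element of A with the
-- k-th element that is not a left endpoint, so [i, j] ∈ LK(A) iff i is not a right endpoint, j is not
-- a left endpoint, and #{non-right endpoints ≤ i} = #{non-left endpoints ≤ j}.  Double counting the
-- elements of A inside [1, x] gives #{non-left ≤ x} ≤ #{non-right ≤ x}, with equality iff no element
-- of A straddles x; this is (1).  In τ₀ the toggle at [i, i] is unaffected by the other minimal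
-- elements, so it adds [i, i] exactly when no element of A is comparable to it.
-- For (2), row⁻¹(LK Ā) is the set of maximal elements outside the up-set generated by LK(Ā), and
-- [a, b] lies in that up-set iff #{non-right endpoints of Ā ≤ a - 1} < #{non-left endpoints of Ā ≤ b}.
-- Passing from A to Ā shifts both endpoint counts by the number σ of minimal elements of A, and the
-- two sides of (2) become the same arithmetic condition.

open import Defs
open import Algebra.Properties.CommutativeSemigroup using (interchange)
open import Data.Bool using (Bool; true; false; _∧_; _∨_; not; T; T?)
open import Data.Bool.ListAction using (any; all; or)
open import Data.Bool.Properties using (∧-zeroʳ)
open import Data.Empty using (⊥; ⊥-elim)
open import Data.List using (List; []; _∷_; _++_; [_]; length; map; upTo; filterᵇ; zip; foldr)
open import Data.List.Membership.Propositional using (_∈_; find; lose)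
open import Data.List.Membership.Propositional.Properties
  using (∈-upTo⁺; ∈-upTo⁻; ∈-map⁺; ∈-map⁻; ∈-concatMap⁺; ∈-concatMap⁻; ∈-filter⁺; ∈-filter⁻)
open import Data.List.Properties using (upTo-∷ʳ; map-++; length-++; filter-++; map-cong)
open import Data.List.Relation.Unary.All using (All; []; _∷_) renaming (lookup to All-lookup)
open import Data.List.Relation.Unary.Any using (here; there)
open import Data.List.Relation.Unary.AllPairs using (_∷_)
open import Data.List.Relation.Unary.Unique.Propositional using (Unique)
import Data.List.Relation.Unary.Unique.Propositional.Properties as Unique
open import Data.Nat using (ℕ; zero; suc; _+_; _∸_; _≤_; _<_; _≤ᵇ_; _≡ᵇ_; z≤n; s≤s; _≤?_)
open import Data.Nat.Properties
open import Data.Product using (_×_; _,_; Σ; proj₁; proj₂; ∃)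
open import Data.Sum using (_⊎_; inj₁; inj₂)
open import Data.Unit using (tt)
open import Function using (_∘_)
open import Function.Bundles using (_⇔_; mk⇔; Equivalence)
open import Function.Properties.Equivalence using () renaming (trans to ⇔-trans; sym to ⇔-sym)
open import Relation.Binary.PropositionalEquality hiding ([_])
open import Relation.Nullary using (¬_; yes; no)

private
  +-interchange : ∀ a b c d → (a + b) + (c + d) ≡ (a + c) + (b + d)
  +-interchange = interchange +-commutativeSemigroup

<⇒≤∸1 : ∀ {c k} → c < k → c ≤ k ∸ 1
<⇒≤∸1 {k = suc _} (s≤s c≤k) = c≤k

≡∸1⇒suc≡ : ∀ {e k} → suc e ≤ k → e ≡ k ∸ 1 → suc e ≡ k
≡∸1⇒suc≡ {k = suc _} _ e≡ = cong suc e≡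

true≢false : ∀ {a} → a ≡ true → a ≡ false → ⊥
true≢false refl ()

¬true⇒false : ∀ {a} → ¬ (a ≡ true) → a ≡ false
¬true⇒false {true} p = ⊥-elim (p refl)
¬true⇒false {false} _ = refl

∧-true⁻ : ∀ {a b} → (a ∧ b) ≡ true → (a ≡ true) × (b ≡ true)
∧-true⁻ {true} {true} _ = refl , refl

∧-true⁺ : ∀ {a b} → a ≡ true → b ≡ true → (a ∧ b) ≡ true
∧-true⁺ refl refl = refl

∨-true⁻ : ∀ {a b} → (a ∨ b) ≡ true → (a ≡ true) ⊎ (b ≡ true)
∨-true⁻ {true} _ = inj₁ refl
∨-true⁻ {false} p = inj₂ p

∨-true⁺ˡ : ∀ {a b} → a ≡ true → (a ∨ b) ≡ true
∨-true⁺ˡ refl = refl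

not-true⁺ : ∀ {a} → a ≡ false → not a ≡ true
not-true⁺ refl = refl

not-true⁻ : ∀ {a} → not a ≡ true → a ≡ false
not-true⁻ {false} _ = refl

not-false⁺ : ∀ {a} → a ≡ true → not a ≡ false
not-false⁺ refl = refl

not-false⁻ : ∀ {a} → not a ≡ false → a ≡ true
not-false⁻ {true} _ = refl

T⇒true : ∀ {a} → T a → a ≡ true
T⇒true {true} _ = refl

true⇒T : ∀ {a} → a ≡ true → T a
true⇒T refl = tt

≤ᵇ-true⁺ : ∀ {m n} → m ≤ n → (m ≤ᵇ n) ≡ true
≤ᵇ-true⁺ = T⇒true ∘ ≤⇒≤ᵇ

≤ᵇ-true⁻ : ∀ {m n} → (m ≤ᵇ n) ≡ true → m ≤ n
≤ᵇ-true⁻ {m} {n} = ≤ᵇ⇒≤ m n ∘ true⇒T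

≡ᵇ-true⁺ : ∀ {m n} → m ≡ n → (m ≡ᵇ n) ≡ true
≡ᵇ-true⁺ {m} {n} = T⇒true ∘ ≡⇒≡ᵇ m n

≡ᵇ-true⁻ : ∀ {m n} → (m ≡ᵇ n) ≡ true → m ≡ n
≡ᵇ-true⁻ {m} {n} = ≡ᵇ⇒≡ m n ∘ true⇒T

eqᵇ-true⁺ : ∀ {p q} → p ≡ q → eqᵇ p q ≡ true
eqᵇ-true⁺ {i , j} refl = ∧-true⁺ (≡ᵇ-true⁺ {i} refl) (≡ᵇ-true⁺ {j} refl)

eqᵇ-true⁻ : ∀ {p q} → eqᵇ p q ≡ true → p ≡ q
eqᵇ-true⁻ {i , j} {k , l} e with ∧-true⁻ {i ≡ᵇ k} e
... | e₁ , e₂ = cong₂ _,_ (≡ᵇ-true⁻ e₁) (≡ᵇ-true⁻ e₂)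

leᵇ-true⁻ : ∀ {i j k l} → leᵇ (i , j) (k , l) ≡ true → (k ≤ i) × (j ≤ l)
leᵇ-true⁻ {i} {j} {k} {l} e with ∧-true⁻ {k ≤ᵇ i} e
... | e₁ , e₂ = ≤ᵇ-true⁻ e₁ , ≤ᵇ-true⁻ e₂

leᵇ-true⁺ : ∀ {i j k l} → k ≤ i → j ≤ l → leᵇ (i , j) (k , l) ≡ true
leᵇ-true⁺ k≤i j≤l = ∧-true⁺ (≤ᵇ-true⁺ k≤i) (≤ᵇ-true⁺ j≤l)

true⇔true⇒≡ : ∀ {a b} → (a ≡ true → b ≡ true) → (b ≡ true → a ≡ true) → a ≡ b
true⇔true⇒≡ {true} a⇒b _ = sym (a⇒b refl)
true⇔true⇒≡ {false} {true} _ b⇒a = b⇒a refl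
true⇔true⇒≡ {false} {false} _ _ = refl

module _ {A : Set} (p : A → Bool) where

  any-true⁻ : ∀ xs → any p xs ≡ true → ∃ λ x → (x ∈ xs) × (p x ≡ true)
  any-true⁻ (x ∷ xs) e with p x in px
  ... | true = x , here refl , px
  ... | false with any-true⁻ xs e
  ... | y , y∈xs , py = y , there y∈xs , py

  any-true⁺ : ∀ {xs x} → x ∈ xs → p x ≡ true → any p xs ≡ true
  any-true⁺ {x ∷ xs} (here refl) px rewrite px = refl
  any-true⁺ {y ∷ xs} (there x∈xs) px with p y
  ... | true = refl
  ... | false = any-true⁺ x∈xs px

  all-true⁻ : ∀ {xs x} → all p xs ≡ true → x ∈ xs → p x ≡ true
  all-true⁻ {y ∷ xs} e (here refl) = proj₁ (∧-true⁻ e)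
  all-true⁻ {y ∷ xs} e (there x∈xs) = all-true⁻ (proj₂ (∧-true⁻ {p y} e)) x∈xs

  all-true⁺ : ∀ xs → (∀ {x} → x ∈ xs → p x ≡ true) → all p xs ≡ true
  all-true⁺ [] _ = refl
  all-true⁺ (x ∷ xs) f = ∧-true⁺ (f (here refl)) (all-true⁺ xs (f ∘ there))

  all-false⁻ : ∀ xs → all p xs ≡ false → ∃ λ x → (x ∈ xs) × (p x ≡ false)
  all-false⁻ (x ∷ xs) e with p x in px
  ... | false = x , here refl , px
  ... | true with all-false⁻ xs e
  ... | y , y∈xs , py = y , there y∈xs , py

any-eqᵇ-true⁻ : ∀ {p} xs → any (λ q → eqᵇ q p) xs ≡ true → p ∈ xs
any-eqᵇ-true⁻ {p} xs e with any-true⁻ (λ q → eqᵇ q p) xs e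
... | q , q∈ , q≡p rewrite eqᵇ-true⁻ {q} q≡p = q∈

any-eqᵇ-true⁺ : ∀ {p} xs → p ∈ xs → any (λ q → eqᵇ q p) xs ≡ true
any-eqᵇ-true⁺ {p} xs p∈ = any-true⁺ (λ q → eqᵇ q p) p∈ (eqᵇ-true⁺ {p} refl)

∈-range⁻ : ∀ {n x} → x ∈ range n → (1 ≤ x) × (x ≤ n)
∈-range⁻ x∈ with ∈-map⁻ suc x∈
... | _ , y∈ , refl = s≤s z≤n , ∈-upTo⁻ y∈

∈-range⁺ : ∀ {n x} → 1 ≤ x → x ≤ n → x ∈ range n
∈-range⁺ {x = suc x} _ x≤n = ∈-map⁺ suc (∈-upTo⁺ x≤n)

private
  intervalsFrom : ℕ → ℕ → List (ℕ × ℕ)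
  intervalsFrom n i = map (i ,_) (filterᵇ (i ≤ᵇ_) (range n))

∈-elements⁻ : ∀ {n i j} → (i , j) ∈ elements n → Valid n i j
∈-elements⁻ {n} x∈ with find (∈-concatMap⁻ (intervalsFrom n) {xs = range n} x∈)
... | k , k∈ , p∈ with ∈-map⁻ (k ,_) p∈
... | _ , j∈ , refl with ∈-filter⁻ (T? ∘ (k ≤ᵇ_)) j∈
... | j∈range , k≤j = proj₁ (∈-range⁻ k∈) , ≤ᵇ⇒≤ _ _ k≤j , proj₂ (∈-range⁻ j∈range)

∈-elements⁺ : ∀ {n i j} → Valid n i j → (i , j) ∈ elements n
∈-elements⁺ {n} {i} (1≤i , i≤j , j≤n) =
  ∈-concatMap⁺ (intervalsFrom n) {xs = range n}
    (lose (∈-range⁺ 1≤i (≤-trans i≤j j≤n))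
          (∈-map⁺ (i ,_) (∈-filter⁺ (T? ∘ (i ≤ᵇ_)) (∈-range⁺ (≤-trans 1≤i i≤j) j≤n) (≤⇒≤ᵇ i≤j))))

any-range-true⁻ : ∀ (p : ℕ → Bool) n → any p (range n) ≡ true → ∃ λ x → (1 ≤ x) × (x ≤ n) × (p x ≡ true)
any-range-true⁻ p n e with any-true⁻ p (range n) e
... | x , x∈ , px = x , proj₁ (∈-range⁻ x∈) , proj₂ (∈-range⁻ {n} x∈) , px

any-elements-true⁻ : ∀ (p : ℕ × ℕ → Bool) n → any p (elements n) ≡ true →
  ∃ λ i → ∃ λ j → Valid n i j × (p (i , j) ≡ true)
any-elements-true⁻ p n e with any-true⁻ p (elements n) e
... | (i , j) , x∈ , px = i , j , ∈-elements⁻ x∈ , px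

𝟙 : Bool → ℕ
𝟙 true = 1
𝟙 false = 0

sumUpTo : (ℕ → ℕ) → ℕ → ℕ
sumUpTo g zero = 0
sumUpTo g (suc x) = g (suc x) + sumUpTo g x

count : (ℕ → Bool) → ℕ → ℕ
count f = sumUpTo (𝟙 ∘ f)

module _ (g h : ℕ → ℕ) where

  sumUpTo-mono-≤ : ∀ x → (∀ y → 1 ≤ y → y ≤ x → g y ≤ h y) → sumUpTo g x ≤ sumUpTo h x
  sumUpTo-mono-≤ zero _ = z≤n
  sumUpTo-mono-≤ (suc x) g≤h =
    +-mono-≤ (g≤h (suc x) (s≤s z≤n) ≤-refl) (sumUpTo-mono-≤ x (λ y 1≤y y≤x → g≤h y 1≤y (m≤n⇒m≤1+n y≤x)))

  sumUpTo-mono-< : ∀ x → (∀ y → 1 ≤ y → y ≤ x → g y ≤ h y) →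
    ∀ z → 1 ≤ z → z ≤ x → g z < h z → sumUpTo g x < sumUpTo h x
  sumUpTo-mono-< zero _ _ (s≤s _) ()
  sumUpTo-mono-< (suc x) g≤h z 1≤z z≤1+x gz<hz = split (m≤n⇒m<n∨m≡n z≤1+x)
    where
    g≤h′ : ∀ y → 1 ≤ y → y ≤ x → g y ≤ h y
    g≤h′ y 1≤y y≤x = g≤h y 1≤y (m≤n⇒m≤1+n y≤x)
    split : z < suc x ⊎ z ≡ suc x → sumUpTo g (suc x) < sumUpTo h (suc x)
    split (inj₂ refl) = +-mono-<-≤ gz<hz (sumUpTo-mono-≤ x g≤h′)
    split (inj₁ (s≤s z≤x)) = +-mono-≤-< (g≤h (suc x) (s≤s z≤n) ≤-refl) (sumUpTo-mono-< x g≤h′ z 1≤z z≤x gz<hz)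

  sumUpTo-+ : ∀ x → sumUpTo (λ y → g y + h y) x ≡ sumUpTo g x + sumUpTo h x
  sumUpTo-+ zero = refl
  sumUpTo-+ (suc x) rewrite sumUpTo-+ x = +-interchange (g (suc x)) (h (suc x)) (sumUpTo g x) (sumUpTo h x)

sumUpTo-0 : ∀ x → sumUpTo (λ _ → 0) x ≡ 0
sumUpTo-0 zero = refl
sumUpTo-0 (suc x) = sumUpTo-0 x

sumUpTo-swap : ∀ (F : ℕ → ℕ → ℕ) x z →
  sumUpTo (λ a → sumUpTo (F a) x) z ≡ sumUpTo (λ b → sumUpTo (λ a → F a b) z) x
sumUpTo-swap F zero z = sumUpTo-0 z
sumUpTo-swap F (suc x) z =
  trans (sumUpTo-+ (λ a → F a (suc x)) (λ a → sumUpTo (F a) x) z)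
        (cong (sumUpTo (λ a → F a (suc x)) z +_) (sumUpTo-swap F x z))

term≤sumUpTo : ∀ (g : ℕ → ℕ) {x y} → 1 ≤ y → y ≤ x → g y ≤ sumUpTo g x
term≤sumUpTo g {zero} (s≤s _) ()
term≤sumUpTo g {suc x} 1≤y y≤1+x with m≤n⇒m<n∨m≡n y≤1+x
... | inj₂ refl = m≤m+n _ _
... | inj₁ (s≤s y≤x) = ≤-trans (term≤sumUpTo g 1≤y y≤x) (m≤n+m _ _)

module _ (f : ℕ → Bool) where

  count-suc-true : ∀ x → f (suc x) ≡ true → count f (suc x) ≡ suc (count f x)
  count-suc-true x fx rewrite fx = refl

  count-suc-false : ∀ x → f (suc x) ≡ false → count f (suc x) ≡ count f x
  count-suc-false x fx rewrite fx = refl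

  count-mono : ∀ {x y} → x ≤ y → count f x ≤ count f y
  count-mono {y = zero} z≤n = z≤n
  count-mono {y = suc y} x≤1+y with m≤n⇒m<n∨m≡n x≤1+y
  ... | inj₂ refl = ≤-refl
  ... | inj₁ (s≤s x≤y) = ≤-trans (count-mono x≤y) (m≤n+m _ _)

  count-+-count-not : ∀ x → count f x + count (not ∘ f) x ≡ x
  count-+-count-not zero = refl
  count-+-count-not (suc x) with f (suc x)
  ... | true = cong suc (count-+-count-not x)
  ... | false = trans (+-suc _ _) (cong suc (count-+-count-not x))

  count-≡0 : ∀ x → (∀ y → 1 ≤ y → y ≤ x → f y ≡ false) → count f x ≡ 0
  count-≡0 zero _ = refl
  count-≡0 (suc x) none rewrite none (suc x) (s≤s z≤n) ≤-refl =
    count-≡0 x (λ y 1≤y y≤x → none y 1≤y (m≤n⇒m≤1+n y≤x))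

  count-≤1 : ∀ x → (∀ y y′ → f y ≡ true → f y′ ≡ true → y ≡ y′) → count f x ≤ 1
  count-≤1 zero _ = z≤n
  count-≤1 (suc x) unique with f (suc x) in fx
  ... | false = count-≤1 x unique
  ... | true = s≤s (≤-reflexive (count-≡0 x (λ y _ y≤x → ¬true⇒false (λ fy →
                  <-irrefl (unique y (suc x) fy fx) (s≤s y≤x)))))

  count-stable : ∀ {i x} → i ≤ x → (∀ s → i < s → s ≤ x → f s ≡ false) → count f x ≡ count f i
  count-stable {x = x} i≤x none with m≤n⇒m<n∨m≡n i≤x
  ... | inj₂ refl = refl
  count-stable {x = suc x} i≤x none | inj₁ (s≤s i≤x′) rewrite none (suc x) (s≤s i≤x′) ≤-refl =
    count-stable i≤x′ (λ s i<s s≤x → none s i<s (m≤n⇒m≤1+n s≤x))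

  count-pos : ∀ {x y} → 1 ≤ y → y ≤ x → f y ≡ true → 1 ≤ count f x
  count-pos 1≤y y≤x fy = ≤-trans (≤-reflexive (cong 𝟙 (sym fy))) (term≤sumUpTo (𝟙 ∘ f) 1≤y y≤x)

  -- count f rises by at most one at each step
  count-attains : ∀ b t → 1 ≤ t → t ≤ count f b → ∃ λ d → (1 ≤ d) × (d ≤ b) × (f d ≡ true) × (count f d ≡ t)
  count-attains zero t 1≤t t≤0 = ⊥-elim (<-irrefl refl (≤-trans 1≤t t≤0))
  count-attains (suc b) t 1≤t t≤ with t ≤? count f b
  ... | yes t≤′ = let d , 1≤d , d≤b , fd , cd = count-attains b t 1≤t t≤′ in d , 1≤d , m≤n⇒m≤1+n d≤b , fd , cd
  ... | no t≰ with f (suc b) in fb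
  ... | true = suc b , s≤s z≤n , ≤-refl , fb , trans (count-suc-true b fb) (≤-antisym (≰⇒> t≰) t≤)
  ... | false = ⊥-elim (t≰ t≤)

module _ (f g : ℕ → Bool) (x : ℕ) where

  count-not-antitone : count f x ≤ count g x → count (not ∘ g) x ≤ count (not ∘ f) x
  count-not-antitone f≤g = +-cancelˡ-≤ (count g x) _ _ (begin
    count g x + count (not ∘ g) x ≡⟨ count-+-count-not g x ⟩
    x                             ≡⟨ count-+-count-not f x ⟨
    count f x + count (not ∘ f) x ≤⟨ +-monoˡ-≤ _ f≤g ⟩
    count g x + count (not ∘ f) x ∎)
    where open ≤-Reasoning

  count-not-antitone-< : count f x < count g x → count (not ∘ g) x < count (not ∘ f) x
  count-not-antitone-< f<g = +-cancelˡ-< (count g x) _ _ (begin-strict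
    count g x + count (not ∘ g) x ≡⟨ count-+-count-not g x ⟩
    x                             ≡⟨ count-+-count-not f x ⟨
    count f x + count (not ∘ f) x <⟨ +-monoˡ-< _ f<g ⟩
    count g x + count (not ∘ f) x ∎)
    where open ≤-Reasoning

data _[_]=_ {A : Set} : List A → ℕ → A → Set where
  first : ∀ {x xs} → (x ∷ xs) [ 0 ]= x
  next  : ∀ {y xs k x} → xs [ k ]= x → (y ∷ xs) [ suc k ]= x

module _ {A : Set} where

  ∈-zip⁻ : ∀ {xs ys : List A} {a b} → (a , b) ∈ zip xs ys → ∃ λ k → (xs [ k ]= a) × (ys [ k ]= b)
  ∈-zip⁻ {_ ∷ _} {_ ∷ _} (here refl) = 0 , first , first
  ∈-zip⁻ {_ ∷ xs} {_ ∷ ys} (there p∈) with ∈-zip⁻ {xs} {ys} p∈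
  ... | k , ak , bk = suc k , next ak , next bk

  ∈-zip⁺ : ∀ {xs ys : List A} {a b k} → xs [ k ]= a → ys [ k ]= b → (a , b) ∈ zip xs ys
  ∈-zip⁺ first first = here refl
  ∈-zip⁺ (next ak) (next bk) = there (∈-zip⁺ ak bk)

  []=-++⁺ˡ : ∀ {xs ys : List A} {k a} → xs [ k ]= a → (xs ++ ys) [ k ]= a
  []=-++⁺ˡ first = first
  []=-++⁺ˡ (next ak) = next ([]=-++⁺ˡ ak)

  []=-++⁺ʳ : ∀ (xs : List A) {ys k a} → ys [ k ]= a → (xs ++ ys) [ length xs + k ]= a
  []=-++⁺ʳ [] ak = ak
  []=-++⁺ʳ (_ ∷ xs) ak = next ([]=-++⁺ʳ xs ak)

  []=-++⁻ : ∀ (xs : List A) {ys k a} → (xs ++ ys) [ k ]= a →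
    (xs [ k ]= a) ⊎ (∃ λ k′ → (k ≡ length xs + k′) × (ys [ k′ ]= a))
  []=-++⁻ [] ak = inj₂ (_ , refl , ak)
  []=-++⁻ (_ ∷ xs) first = inj₁ first
  []=-++⁻ (_ ∷ xs) (next ak) with []=-++⁻ xs ak
  ... | inj₁ ak′ = inj₁ (next ak′)
  ... | inj₂ (k′ , refl , ak′) = inj₂ (k′ , refl , ak′)

hits : (ℕ → Bool) → ℕ → List ℕ
hits p n = filterᵇ p (range n)

range-suc : ∀ n → range (suc n) ≡ range n ++ [ suc n ]
range-suc n = trans (cong (map suc) (sym (upTo-∷ʳ n))) (map-++ suc (upTo n) [ n ])

module _ (p : ℕ → Bool) where

  hits-suc : ∀ n → hits p (suc n) ≡ hits p n ++ filterᵇ p [ suc n ]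
  hits-suc n = trans (cong (filterᵇ p) (range-suc n)) (filter-++ (T? ∘ p) (range n) [ suc n ])

  length-hits : ∀ n → length (hits p n) ≡ count p n
  length-hits zero = refl
  length-hits (suc n) rewrite hits-suc n | length-++ (hits p n) {filterᵇ p [ suc n ]} | length-hits n
    with p (suc n)
  ... | true = +-comm (count p n) 1
  ... | false = +-identityʳ (count p n)

  hits-[]=⁻ : ∀ n {k a} → hits p n [ k ]= a → (1 ≤ a) × (a ≤ n) × (p a ≡ true) × (count p a ≡ suc k)
  hits-[]=⁻ (suc n) ak rewrite hits-suc n with []=-++⁻ (hits p n) ak
  ... | inj₁ ak′ = let 1≤a , a≤n , pa , ca = hits-[]=⁻ n ak′ in 1≤a , m≤n⇒m≤1+n a≤n , pa , ca
  ... | inj₂ (k′ , k≡ , ak′) with p (suc n) in pn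
  hits-[]=⁻ (suc n) _ | inj₂ (zero , k≡ , first) | true =
    s≤s z≤n , ≤-refl , pn ,
    trans (count-suc-true p n pn) (cong suc (trans (sym (length-hits n)) (trans (sym (+-identityʳ _)) (sym k≡))))

  hits-[]=⁺ : ∀ n {k a} → 1 ≤ a → a ≤ n → p a ≡ true → count p a ≡ suc k → hits p n [ k ]= a
  hits-[]=⁺ zero 1≤a a≤0 _ _ = ⊥-elim (<-irrefl refl (≤-trans 1≤a a≤0))
  hits-[]=⁺ (suc n) {k} 1≤a a≤1+n pa ca rewrite hits-suc n with m≤n⇒m<n∨m≡n a≤1+n
  ... | inj₁ (s≤s a≤n) = []=-++⁺ˡ (hits-[]=⁺ n 1≤a a≤n pa ca)
  ... | inj₂ refl rewrite pa =
    subst (λ u → (hits p n ++ [ suc n ]) [ u ]= suc n) length≡k ([]=-++⁺ʳ (hits p n) first)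
    where
    length≡k : length (hits p n) + 0 ≡ k
    length≡k = trans (+-identityʳ _) (trans (length-hits n) (suc-injective ca))

module _ (P Q : ℕ → Bool) (n : ℕ) where

  ∈-zip-hits⁻ : ∀ {i j} → (i , j) ∈ zip (hits P n) (hits Q n) →
    (1 ≤ i) × (i ≤ n) × (1 ≤ j) × (j ≤ n) × (P i ≡ true) × (Q j ≡ true) × (count P i ≡ count Q j)
  ∈-zip-hits⁻ ij∈ with ∈-zip⁻ ij∈
  ... | k , ik , jk with hits-[]=⁻ P n ik | hits-[]=⁻ Q n jk
  ... | 1≤i , i≤n , Pi , ci | 1≤j , j≤n , Qj , cj = 1≤i , i≤n , 1≤j , j≤n , Pi , Qj , trans ci (sym cj)

  ∈-zip-hits⁺ : ∀ {i j} → 1 ≤ i → i ≤ n → 1 ≤ j → j ≤ n → P i ≡ true → Q j ≡ true → count P i ≡ count Q j →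
    (i , j) ∈ zip (hits P n) (hits Q n)
  ∈-zip-hits⁺ {suc i} 1≤i i≤n 1≤j j≤n Pi Qj ci≡cj =
    ∈-zip⁺ (hits-[]=⁺ P n 1≤i i≤n Pi (count-suc-true P i Pi))
           (hits-[]=⁺ Q n 1≤j j≤n Qj (trans (sym ci≡cj) (count-suc-true P i Pi)))

module Antichain (n : ℕ) (A : ASet) (antichain : IsAntichain n A) where

  valid : ∀ a b → A a b ≡ true → Valid n a b
  valid = proj₁ antichain

  incomparable : ∀ i j k l → A i j ≡ true → A k l ≡ true → k ≤ i → j ≤ l → (i ≡ k) × (j ≡ l)
  incomparable = proj₂ antichain

  isLeft isRight : ℕ → Bool
  isLeft = isLeftᵇ n A
  isRight = isRightᵇ n A

  isLeft-true⁻ : ∀ {a} → isLeft a ≡ true → ∃ λ b → A a b ≡ true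
  isLeft-true⁻ {a} e with any-range-true⁻ (A a) n e
  ... | b , _ , _ , ab = b , ab

  isLeft-true⁺ : ∀ {a b} → A a b ≡ true → isLeft a ≡ true
  isLeft-true⁺ {a} {b} ab = let 1≤a , a≤b , b≤n = valid a b ab in
    any-true⁺ (A a) (∈-range⁺ (≤-trans 1≤a a≤b) b≤n) ab

  isRight-true⁻ : ∀ {b} → isRight b ≡ true → ∃ λ a → A a b ≡ true
  isRight-true⁻ {b} e with any-range-true⁻ (λ a → A a b) n e
  ... | a , _ , _ , ab = a , ab

  isRight-true⁺ : ∀ {a b} → A a b ≡ true → isRight b ≡ true
  isRight-true⁺ {a} {b} ab = let 1≤a , a≤b , b≤n = valid a b ab in
    any-true⁺ (λ a → A a b) (∈-range⁺ 1≤a (≤-trans a≤b b≤n)) ab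

  right-unique : ∀ {a b b′} → A a b ≡ true → A a b′ ≡ true → b ≡ b′
  right-unique {a} {b} {b′} ab ab′ with ≤-total b b′
  ... | inj₁ b≤b′ = proj₂ (incomparable a b a b′ ab ab′ ≤-refl b≤b′)
  ... | inj₂ b′≤b = sym (proj₂ (incomparable a b′ a b ab′ ab ≤-refl b′≤b))

  left-unique : ∀ {a a′ b} → A a b ≡ true → A a′ b ≡ true → a ≡ a′
  left-unique {a} {a′} {b} ab a′b with ≤-total a a′
  ... | inj₁ a≤a′ = sym (proj₁ (incomparable a′ b a b a′b ab a≤a′ ≤-refl))
  ... | inj₂ a′≤a = proj₁ (incomparable a b a′ b ab a′b a′≤a ≤-refl)


  inside : ℕ → ℕ
  inside x = sumUpTo (λ a → count (A a) x) x

  Closed : ℕ → Set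
  Closed x = ∀ a b → A a b ≡ true → a ≤ x → b ≤ x

  private
    count-row≤𝟙 : ∀ x a → count (A a) x ≤ 𝟙 (isLeft a)
    count-row≤𝟙 x a with isLeft a in la
    ... | true = count-≤1 (A a) x (λ _ _ → right-unique)
    ... | false = ≤-reflexive (count-≡0 (A a) x (λ b _ _ → ¬true⇒false (λ ab → true≢false (isLeft-true⁺ ab) la)))

    𝟙≤count-row : ∀ x → Closed x → ∀ a → 1 ≤ a → a ≤ x → 𝟙 (isLeft a) ≤ count (A a) x
    𝟙≤count-row x closed a _ a≤x with isLeft a in la
    ... | false = z≤n
    ... | true = let b , ab = isLeft-true⁻ la ; 1≤a , a≤b , _ = valid a b ab in
      count-pos (A a) (≤-trans 1≤a a≤b) (closed a b ab a≤x) ab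

    count-column≤𝟙 : ∀ x b → count (λ a → A a b) x ≤ 𝟙 (isRight b)
    count-column≤𝟙 x b with isRight b in rb
    ... | true = count-≤1 (λ a → A a b) x (λ _ _ → left-unique)
    ... | false = ≤-reflexive (count-≡0 _ x (λ a _ _ → ¬true⇒false (λ ab → true≢false (isRight-true⁺ ab) rb)))

    𝟙≤count-column : ∀ x b → 1 ≤ b → b ≤ x → 𝟙 (isRight b) ≤ count (λ a → A a b) x
    𝟙≤count-column x b _ b≤x with isRight b in rb
    ... | false = z≤n
    ... | true = let a , ab = isRight-true⁻ rb ; 1≤a , a≤b , _ = valid a b ab in
      count-pos (λ a → A a b) 1≤a (≤-trans a≤b b≤x) ab

    inside-by-columns : ∀ x → inside x ≡ sumUpTo (λ b → count (λ a → A a b) x) x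
    inside-by-columns x = sumUpTo-swap (λ a b → 𝟙 (A a b)) x x

  count-isRight≤count-isLeft : ∀ x → count isRight x ≤ count isLeft x
  count-isRight≤count-isLeft x = begin
    count isRight x                            ≤⟨ sumUpTo-mono-≤ _ _ x (λ b → 𝟙≤count-column x b) ⟩
    sumUpTo (λ b → count (λ a → A a b) x) x    ≡⟨ inside-by-columns x ⟨
    inside x                                   ≤⟨ sumUpTo-mono-≤ _ _ x (λ a _ _ → count-row≤𝟙 x a) ⟩
    count isLeft x                             ∎
    where open ≤-Reasoning

  count-isLeft≤count-isRight : ∀ x → Closed x → count isLeft x ≤ count isRight x
  count-isLeft≤count-isRight x closed = begin
    count isLeft x                             ≤⟨ sumUpTo-mono-≤ _ _ x (𝟙≤count-row x closed) ⟩
    inside x                                   ≡⟨ inside-by-columns x ⟩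
    sumUpTo (λ b → count (λ a → A a b) x) x    ≤⟨ sumUpTo-mono-≤ _ _ x (λ b _ _ → count-column≤𝟙 x b) ⟩
    count isRight x                            ∎
    where open ≤-Reasoning

  -- an element [k, l] straddling x is counted by its left endpoint only
  count-isRight<count-isLeft : ∀ x {k l} → A k l ≡ true → k ≤ x → x < l → count isRight x < count isLeft x
  count-isRight<count-isLeft x {k} {l} kl k≤x x<l = begin-strict
    count isRight x                            ≤⟨ sumUpTo-mono-≤ _ _ x (λ b → 𝟙≤count-column x b) ⟩
    sumUpTo (λ b → count (λ a → A a b) x) x    ≡⟨ inside-by-columns x ⟨
    inside x                                   <⟨ sumUpTo-mono-< _ _ x (λ a _ _ → count-row≤𝟙 x a) k
                                                    (proj₁ (valid k l kl)) k≤x row-k<1 ⟩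
    count isLeft x                             ∎
    where
    open ≤-Reasoning
    row-k<1 : count (A k) x < 𝟙 (isLeft k)
    row-k<1 rewrite isLeft-true⁺ kl | count-≡0 (A k) x (λ y _ y≤x → ¬true⇒false (λ ky →
      <⇒≱ x<l (≤-trans (≤-reflexive (right-unique kl ky)) y≤x))) = s≤s z≤n

  nonLeft nonRight : ℕ → ℕ
  nonLeft = count (not ∘ isLeft)
  nonRight = count (not ∘ isRight)

  nonLeft≤nonRight : ∀ x → nonLeft x ≤ nonRight x
  nonLeft≤nonRight x = count-not-antitone isRight isLeft x (count-isRight≤count-isLeft x)

  nonLeft<nonRight : ∀ x {k l} → A k l ≡ true → k ≤ x → x < l → nonLeft x < nonRight x
  nonLeft<nonRight x kl k≤x x<l = count-not-antitone-< isRight isLeft x (count-isRight<count-isLeft x kl k≤x x<l)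

  nonRight≡nonLeft : ∀ x → Closed x → nonRight x ≡ nonLeft x
  nonRight≡nonLeft x closed =
    ≤-antisym (count-not-antitone isLeft isRight x (count-isLeft≤count-isRight x closed)) (nonLeft≤nonRight x)

  LK-true⁻ : ∀ {i j} → LK n A i j ≡ true →
    (1 ≤ i) × (i ≤ n) × (1 ≤ j) × (j ≤ n) × (isRight i ≡ false) × (isLeft j ≡ false) × (nonRight i ≡ nonLeft j)
  LK-true⁻ e with ∈-zip-hits⁻ (not ∘ isRight) (not ∘ isLeft) n (any-eqᵇ-true⁻ _ e)
  ... | 1≤i , i≤n , 1≤j , j≤n , ri , lj , c = 1≤i , i≤n , 1≤j , j≤n , not-true⁻ ri , not-true⁻ lj , c

  LK-true⁺ : ∀ {i j} → 1 ≤ i → i ≤ n → 1 ≤ j → j ≤ n →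
    isRight i ≡ false → isLeft j ≡ false → nonRight i ≡ nonLeft j → LK n A i j ≡ true
  LK-true⁺ 1≤i i≤n 1≤j j≤n ri lj c =
    any-eqᵇ-true⁺ _ (∈-zip-hits⁺ (not ∘ isRight) (not ∘ isLeft) n 1≤i i≤n 1≤j j≤n (not-true⁺ ri) (not-true⁺ lj) c)

  Covered : ℕ → Set
  Covered i = Σ ℕ (λ k → Σ ℕ (λ l → (A k l ≡ true) × (k ≤ i) × (i ≤ l)))

  LK-diagonal : ∀ {i} → 1 ≤ i → i ≤ n → (LK n A i i ≡ true) ⇔ (¬ Covered i)
  LK-diagonal {i} 1≤i i≤n = mk⇔ uncovered diagonal
    where
    uncovered : LK n A i i ≡ true → ¬ Covered i
    uncovered e (k , l , kl , k≤i , i≤l) with LK-true⁻ e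
    ... | _ , _ , _ , _ , ri , _ , c with m≤n⇒m<n∨m≡n i≤l
    ... | inj₂ refl = true≢false (isRight-true⁺ kl) ri
    ... | inj₁ i<l = <⇒≢ (nonLeft<nonRight i kl k≤i i<l) (sym c)
    diagonal : ¬ Covered i → LK n A i i ≡ true
    diagonal uncov = LK-true⁺ 1≤i i≤n 1≤i i≤n ri li (nonRight≡nonLeft i closed)
      where
      ri : isRight i ≡ false
      ri = ¬true⇒false (λ r → let a , ai = isRight-true⁻ r in uncov (a , i , ai , proj₁ (proj₂ (valid a i ai)) , ≤-refl))
      li : isLeft i ≡ false
      li = ¬true⇒false (λ l → let b , ib = isLeft-true⁻ l in uncov (i , b , ib , ≤-refl , proj₁ (proj₂ (valid i b ib))))
      closed : Closed i
      closed a b ab a≤i with b ≤? i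
      ... | yes b≤i = b≤i
      ... | no b≰i = ⊥-elim (uncov (a , b , ab , a≤i , <⇒≤ (≰⇒> b≰i)))

module Toggles (n : ℕ) (A : ASet) (antichain : IsAntichain n A) where

  open Antichain n A antichain using (valid; Covered)

  toggles : List ℕ → ASet
  toggles = foldr (λ i B → toggle n (i , i) B) A

  comparableᵇ : ℕ → ℕ × ℕ → Bool
  comparableᵇ i q = leᵇ (i , i) q ∨ leᵇ q (i , i)

  private
    diagonal-comparable : ∀ {i x} → comparableᵇ i (x , x) ≡ true → i ≡ x
    diagonal-comparable {i} {x} e with ∨-true⁻ {leᵇ (i , i) (x , x)} e
    ... | inj₁ le = let x≤i , i≤x = leᵇ-true⁻ {i} le in ≤-antisym i≤x x≤i
    ... | inj₂ le = let i≤x , x≤i = leᵇ-true⁻ {x} le in ≤-antisym i≤x x≤i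

  toggles-diagonal-fresh : ∀ {i} l → All (i ≢_) l → toggles l i i ≡ A i i
  toggles-diagonal-fresh [] _ = refl
  toggles-diagonal-fresh {i} (x ∷ l) (i≢x ∷ fresh) with eqᵇ (i , i) (x , x) in e
  ... | true = ⊥-elim (i≢x (cong proj₁ (eqᵇ-true⁻ {i , i} e)))
  ... | false = toggles-diagonal-fresh l fresh

  -- the only minimal element comparable to [i, i] is [i, i] itself
  toggles-comparable-fresh : ∀ {i} l → All (i ≢_) l → ∀ k m →
    (toggles l k m ∧ comparableᵇ i (k , m)) ≡ (A k m ∧ comparableᵇ i (k , m))
  toggles-comparable-fresh [] _ k m = refl
  toggles-comparable-fresh {i} (x ∷ l) (i≢x ∷ fresh) k m with eqᵇ (k , m) (x , x) in e
  ... | false = toggles-comparable-fresh l fresh k m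
  ... | true with eqᵇ-true⁻ {k , m} e
  ... | refl with comparableᵇ i (x , x) in c
  ... | true = ⊥-elim (i≢x (diagonal-comparable {i} c))
  ... | false = trans (∧-zeroʳ _) (sym (∧-zeroʳ _))

  comparableInᵇ-true⁻ : ∀ {i} → comparableInᵇ n A (i , i) ≡ true → Covered i
  comparableInᵇ-true⁻ {i} e with any-elements-true⁻ _ n e
  ... | k , l , (_ , k≤l , _) , q with ∧-true⁻ {A k l} q
  ... | kl , c with ∨-true⁻ {leᵇ (i , i) (k , l)} c
  ... | inj₁ le = let k≤i , i≤l = leᵇ-true⁻ {i} le in k , l , kl , k≤i , i≤l
  ... | inj₂ le = let i≤k , l≤i = leᵇ-true⁻ {k} le in k , l , kl , ≤-trans k≤l l≤i , ≤-trans i≤k k≤l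

  comparableInᵇ-true⁺ : ∀ {i} → Covered i → comparableInᵇ n A (i , i) ≡ true
  comparableInᵇ-true⁺ {i} (k , l , kl , k≤i , i≤l) =
    any-true⁺ _ (∈-elements⁺ (valid k l kl)) (∧-true⁺ kl (∨-true⁺ˡ (leᵇ-true⁺ {i} k≤i i≤l)))

  toggle-diagonal : ∀ {i} → 1 ≤ i → i ≤ n → ∀ B → B i i ≡ A i i →
    (∀ k m → (B k m ∧ comparableᵇ i (k , m)) ≡ (A k m ∧ comparableᵇ i (k , m))) →
    (toggle n (i , i) B i i ≡ true) ⇔ (¬ Covered i)
  toggle-diagonal {i} 1≤i i≤n B Bii≡ B≡ rewrite eqᵇ-true⁺ {i , i} refl | Bii≡
    | cong or (map-cong (λ q → B≡ (proj₁ q) (proj₂ q)) (elements n)) with A i i in aii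
  ... | true = mk⇔ (λ ()) (λ uncov → ⊥-elim (uncov (i , i , aii , ≤-refl , ≤-refl)))
  ... | false rewrite ≤ᵇ-true⁺ 1≤i | ≤ᵇ-true⁺ (≤-refl {i}) | ≤ᵇ-true⁺ i≤n =
    mk⇔ (λ e cov → true≢false (comparableInᵇ-true⁺ cov) (not-true⁻ e))
        (λ uncov → not-true⁺ (¬true⇒false (uncov ∘ comparableInᵇ-true⁻)))

  toggles-diagonal : ∀ {i} → 1 ≤ i → i ≤ n → ∀ l → i ∈ l → Unique l → (toggles l i i ≡ true) ⇔ (¬ Covered i)
  toggles-diagonal {i} 1≤i i≤n (x ∷ l) (here refl) (x∉l ∷ _) =
    toggle-diagonal 1≤i i≤n (toggles l) (toggles-diagonal-fresh l x∉l) (toggles-comparable-fresh l x∉l)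
  toggles-diagonal {i} 1≤i i≤n (x ∷ l) (there i∈l) (x∉l ∷ unique) with eqᵇ (i , i) (x , x) in e
  ... | false = toggles-diagonal 1≤i i≤n l i∈l unique
  ... | true = ⊥-elim (All-lookup x∉l i∈l (sym (cong proj₁ (eqᵇ-true⁻ {i , i} e))))

  tau0-diagonal : ∀ {i} → 1 ≤ i → i ≤ n → (tau0 n A i i ≡ true) ⇔ (¬ Covered i)
  tau0-diagonal 1≤i i≤n =
    toggles-diagonal 1≤i i≤n (range n) (∈-range⁺ 1≤i i≤n) (Unique.map⁺ suc-injective (Unique.upTo⁺ n))

-- Recovering an antichain from its rowmotion image

module Rowmotion (m : ℕ) (C : ASet) (antichain : IsAntichain m C) where

  open Antichain m C antichain using (valid; incomparable)

  Below : ℕ → ℕ → Set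
  Below a b = Σ ℕ λ c → Σ ℕ λ d → (C c d ≡ true) × (c ≤ a) × (b ≤ d)

  AboveRow : ℕ → ℕ → Set
  AboveRow a b = Σ ℕ λ c → Σ ℕ λ d → (rowA m C c d ≡ true) × (a ≤ c) × (d ≤ b)

  notBelowᵇ-true⁻ : ∀ {a b} → notBelowᵇ m C (a , b) ≡ true → ¬ Below a b
  notBelowᵇ-true⁻ e (c , d , cd , c≤a , b≤d) =
    true≢false (∧-true⁺ cd (leᵇ-true⁺ c≤a b≤d)) (not-true⁻ (all-true⁻ _ e (∈-elements⁺ (valid c d cd))))

  notBelowᵇ-true⁺ : ∀ {a b} → ¬ Below a b → notBelowᵇ m C (a , b) ≡ true
  notBelowᵇ-true⁺ {a} {b} notBelow = all-true⁺ _ (elements m) (λ {(c , d)} _ →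
    not-true⁺ (¬true⇒false (λ e → let cd , le = ∧-true⁻ {C c d} e ; c≤a , b≤d = leᵇ-true⁻ {a} le in
      notBelow (c , d , cd , c≤a , b≤d))))

  notBelowᵇ-false⁻ : ∀ {a b} → notBelowᵇ m C (a , b) ≡ false → Below a b
  notBelowᵇ-false⁻ {a} e with all-false⁻ _ (elements m) e
  ... | (c , d) , _ , e′ with ∧-true⁻ {C c d} (not-false⁻ e′)
  ... | cd , le = let c≤a , b≤d = leᵇ-true⁻ {a} le in c , d , cd , c≤a , b≤d

  aboveRow⇒¬below : ∀ {a b} → AboveRow a b → ¬ Below a b
  aboveRow⇒¬below {a} (c , d , r , a≤c , d≤b) (c′ , d′ , c′d′ , c′≤a , b≤d′) =
    notBelowᵇ-true⁻ (proj₁ (∧-true⁻ (proj₂ (∧-true⁻ {validᵇ m c d} r))))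
      (c′ , d′ , c′d′ , ≤-trans c′≤a a≤c , ≤-trans d≤b b≤d′)

  private
    rank-< : ∀ {a b c d} → a ≤ c → d ≤ b → c ≤ d → ¬ ((c ≡ a) × (d ≡ b)) → d ∸ c < b ∸ a
    rank-< {a} {b} {c} {d} a≤c d≤b c≤d ≢ with m≤n⇒m<n∨m≡n a≤c
    ... | inj₁ a<c = ≤-<-trans (∸-monoˡ-≤ c d≤b) (∸-monoʳ-< a<c (≤-trans c≤d d≤b))
    ... | inj₂ refl with m≤n⇒m<n∨m≡n d≤b
    ... | inj₁ d<b = ∸-monoˡ-< d<b c≤d
    ... | inj₂ refl = ⊥-elim (≢ (refl , refl))

    -- descend to a minimal element outside the down-set of C, i.e. to an element of rowA m C
    descend : ∀ k a b → b ∸ a < k → Valid m a b → notBelowᵇ m C (a , b) ≡ true → AboveRow a b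
    descend (suc k) a b rank< v@(1≤a , a≤b , b≤m) e
      with any (λ y → leᵇ y (a , b) ∧ not (eqᵇ y (a , b)) ∧ notBelowᵇ m C y) (elements m) in smaller
    ... | false = a , b , minimal , ≤-refl , ≤-refl
      where
      minimal : rowA m C a b ≡ true
      minimal rewrite smaller | e | ≤ᵇ-true⁺ 1≤a | ≤ᵇ-true⁺ a≤b | ≤ᵇ-true⁺ b≤m = refl
    ... | true with any-elements-true⁻ _ m smaller
    ... | c , d , vcd@(_ , c≤d , _) , e′ with ∧-true⁻ {leᵇ (c , d) (a , b)} e′
    ... | le , e″ with ∧-true⁻ {not (eqᵇ (c , d) (a , b))} e″ | leᵇ-true⁻ {c} le
    ... | ≢ , notBelow | a≤c , d≤b
      with descend k c d (≤-trans (rank-< a≤c d≤b c≤d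
             (λ { (refl , refl) → true≢false (eqᵇ-true⁺ {c , d} refl) (not-true⁻ ≢) })) (≤-pred rank<)) vcd notBelow
    ... | c′ , d′ , r , c≤c′ , d′≤d = c′ , d′ , r , ≤-trans a≤c c≤c′ , ≤-trans d′≤d d≤b

  ¬below⇒aboveRow : ∀ {a b} → Valid m a b → ¬ Below a b → AboveRow a b
  ¬below⇒aboveRow {a} {b} v notBelow = descend (suc (b ∸ a)) a b ≤-refl v (notBelowᵇ-true⁺ notBelow)

  -- the upper covers of [a, b] are [a - 1, b] and [a, b + 1]
  MaximalOutside : ℕ → ℕ → Set
  MaximalOutside a b = Valid m a b × (¬ AboveRow a b) × ((a ≡ 1) ⊎ AboveRow (a ∸ 1) b) × ((b ≡ m) ⊎ AboveRow a (suc b))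

  C⇒maximalOutside : ∀ {a b} → C a b ≡ true → MaximalOutside a b
  C⇒maximalOutside {a} {b} ab = v , (λ above → aboveRow⇒¬below above (a , b , ab , ≤-refl , ≤-refl)) , left a v ab , right
    where
    v = valid a b ab
    left : ∀ a → Valid m a b → C a b ≡ true → (a ≡ 1) ⊎ AboveRow (a ∸ 1) b
    left (suc zero) _ _ = inj₁ refl
    left (suc (suc a)) (_ , a≤b , b≤m) ab = inj₂ (¬below⇒aboveRow (s≤s z≤n , ≤-trans (n≤1+n _) a≤b , b≤m)
      (λ (c , d , cd , c≤a , b≤d) →
        <-irrefl (sym (proj₁ (incomparable _ _ c d ab cd (≤-trans c≤a (n≤1+n _)) b≤d))) (s≤s c≤a)))
    right : (b ≡ m) ⊎ AboveRow a (suc b)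
    right with m≤n⇒m<n∨m≡n (proj₂ (proj₂ v))
    ... | inj₂ b≡m = inj₁ b≡m
    ... | inj₁ b<m = inj₂ (¬below⇒aboveRow (proj₁ v , ≤-trans (proj₁ (proj₂ v)) (n≤1+n _) , b<m)
      (λ (c , d , cd , c≤a , b<d) → <-irrefl (proj₂ (incomparable a b c d ab cd c≤a (≤-trans (n≤1+n _) b<d))) b<d))

  maximalOutside⇒C : ∀ {a b} → MaximalOutside a b → C a b ≡ true
  maximalOutside⇒C {a} {b} (v , notAbove , leftCover , rightCover) with notBelowᵇ m C (a , b) in nb
  ... | true = ⊥-elim (notAbove (¬below⇒aboveRow v (notBelowᵇ-true⁻ nb)))
  ... | false with notBelowᵇ-false⁻ nb
  ... | c , d , cd , c≤a , b≤d with m≤n⇒m<n∨m≡n c≤a | m≤n⇒m<n∨m≡n b≤d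
  ... | inj₂ refl | inj₂ refl = cd
  ... | inj₁ c<a | _ = ⊥-elim (aboveLeft leftCover)
    where
    aboveLeft : ¬ ((a ≡ 1) ⊎ AboveRow (a ∸ 1) b)
    aboveLeft (inj₁ refl) = <-irrefl refl (≤-trans (s≤s (proj₁ (valid c d cd))) c<a)
    aboveLeft (inj₂ above) = aboveRow⇒¬below above (c , d , cd , <⇒≤∸1 c<a , b≤d)
  ... | inj₂ _ | inj₁ b<d = ⊥-elim (aboveRight rightCover)
    where
    aboveRight : ¬ ((b ≡ m) ⊎ AboveRow a (suc b))
    aboveRight (inj₁ refl) = <-irrefl refl (≤-trans b<d (proj₂ (proj₂ (valid c d cd))))
    aboveRight (inj₂ above) = aboveRow⇒¬below above (c , d , cd , c≤a , b<d)

module LKUpSet (n : ℕ) (A : ASet) (antichain : IsAntichain n A) where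

  open Antichain n A antichain

  AboveLK : ℕ → ℕ → Set
  AboveLK a b = Σ ℕ λ c → Σ ℕ λ d → (LK n A c d ≡ true) × (a ≤ c) × (d ≤ b)

  aboveLK⇒< : ∀ {a b} → 1 ≤ a → AboveLK a b → nonRight (a ∸ 1) < nonLeft b
  aboveLK⇒< {suc a} {b} _ (suc c , d , cd , 1+a≤1+c , d≤b) with LK-true⁻ cd
  ... | _ , _ , _ , _ , rc , _ , c≡d = begin-strict
    nonRight a          ≤⟨ count-mono _ (≤-pred 1+a≤1+c) ⟩
    nonRight c          <⟨ n<1+n _ ⟩
    suc (nonRight c)    ≡⟨ count-suc-true _ c (not-true⁺ rc) ⟨
    nonRight (suc c)    ≡⟨ c≡d ⟩
    nonLeft d           ≤⟨ count-mono _ d≤b ⟩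
    nonLeft b           ∎
    where open ≤-Reasoning
  aboveLK⇒< {suc a} _ (zero , d , cd , () , _)

  -- take the pair of LK(A) whose index is one more than the number of non-right endpoints before a
  <⇒aboveLK : ∀ {a b} → 1 ≤ a → b ≤ n → nonRight (a ∸ 1) < nonLeft b → AboveLK a b
  <⇒aboveLK {suc a} {b} _ b≤n < with count-attains (not ∘ isLeft) b (suc (nonRight a)) (s≤s z≤n) <
  ... | d , 1≤d , d≤b , ld , cd with count-attains (not ∘ isRight) d (suc (nonRight a)) (s≤s z≤n)
                                       (≤-trans (≤-reflexive (sym cd)) (nonLeft≤nonRight d))
  ... | c , 1≤c , c≤d , rc , cc =
    c , d , LK-true⁺ 1≤c (≤-trans c≤d d≤n) 1≤d d≤n (not-true⁻ rc) (not-true⁻ ld) (trans cc (sym cd)) , a<c , d≤b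
    where
    d≤n = ≤-trans d≤b b≤n
    a<c : suc a ≤ c
    a<c with suc a ≤? c
    ... | yes a<c = a<c
    ... | no a≮c = ⊥-elim (<-irrefl refl (≤-trans (≤-reflexive (sym cc)) (count-mono _ (≤-pred (≰⇒> a≮c)))))

  -- [a + 1, b] is a maximal element outside the up-set generated by LK(A)
  MaximalOutsideLK : ℕ → ℕ → Set
  MaximalOutsideLK a b =
    (nonLeft b ≤ nonRight a) × ((a ≡ 0) ⊎ (nonRight (a ∸ 1) < nonLeft b)) × ((b ≡ n) ⊎ (nonRight a < nonLeft (suc b)))

module Bar (n : ℕ) (A : ASet) (antichain : IsAntichain n A) where

  m : ℕ
  m = n ∸ 1

  open Antichain n A antichain using (valid; incomparable; isLeft; isRight; isLeft-true⁻; isLeft-true⁺;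
    isRight-true⁻; isRight-true⁺; right-unique; left-unique; nonLeft; nonRight; nonRight≡nonLeft; LK-true⁻; LK-true⁺)

  bar-antichain : IsAntichain m (bar A)
  bar-antichain = bar-valid , bar-incomparable
    where
    bar-valid : ∀ a c → bar A a c ≡ true → Valid m a c
    bar-valid a c e with ∧-true⁻ {A a (suc c)} e
    ... | ac , a≤c = let 1≤a , _ , 1+c≤n = valid a (suc c) ac in 1≤a , ≤ᵇ-true⁻ a≤c , <⇒≤∸1 1+c≤n
    bar-incomparable : ∀ i j k l → bar A i j ≡ true → bar A k l ≡ true → k ≤ i → j ≤ l → (i ≡ k) × (j ≡ l)
    bar-incomparable i j k l e e′ k≤i j≤l with incomparable i (suc j) k (suc l)
      (proj₁ (∧-true⁻ {A i (suc j)} e)) (proj₁ (∧-true⁻ {A k (suc l)} e′)) k≤i (s≤s j≤l)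
    ... | i≡k , 1+j≡1+l = i≡k , suc-injective 1+j≡1+l

  module Ā where
    open Antichain m (bar A) bar-antichain public
    open LKUpSet m (bar A) bar-antichain public using (MaximalOutsideLK)

  σ : ℕ → ℕ
  σ = count (λ s → A s s)

  isLeft-bar : ∀ y → Ā.isLeft y ≡ isLeft y ∧ not (A y y)
  isLeft-bar y = true⇔true⇒≡ to from
    where
    to : Ā.isLeft y ≡ true → (isLeft y ∧ not (A y y)) ≡ true
    to e with Ā.isLeft-true⁻ e
    ... | c , e′ with ∧-true⁻ {A y (suc c)} e′
    ... | yc , y≤c = ∧-true⁺ (isLeft-true⁺ yc) (not-true⁺ (¬true⇒false (λ yy →
                       <-irrefl (right-unique yy yc) (s≤s (≤ᵇ-true⁻ y≤c)))))
    from : (isLeft y ∧ not (A y y)) ≡ true → Ā.isLeft y ≡ true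
    from e with ∧-true⁻ {isLeft y} e
    ... | ly , nyy with isLeft-true⁻ ly
    ... | suc c , yb = Ā.isLeft-true⁺ {b = c} (∧-true⁺ yb (≤ᵇ-true⁺ (≤-pred y<b)))
      where
      y<b : y < suc c
      y<b = ≤∧≢⇒< (proj₁ (proj₂ (valid y (suc c) yb))) (λ { refl → true≢false yb (not-true⁻ nyy) })
    ... | zero , yb = ⊥-elim (<-irrefl refl (≤-trans (proj₁ (valid y 0 yb)) (proj₁ (proj₂ (valid y 0 yb)))))

  isRight-bar : ∀ c → Ā.isRight c ≡ isRight (suc c) ∧ not (A (suc c) (suc c))
  isRight-bar c = true⇔true⇒≡ to from
    where
    to : Ā.isRight c ≡ true → (isRight (suc c) ∧ not (A (suc c) (suc c))) ≡ true
    to e with Ā.isRight-true⁻ e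
    ... | a , e′ with ∧-true⁻ {A a (suc c)} e′
    ... | ac , a≤c = ∧-true⁺ (isRight-true⁺ ac) (not-true⁺ (¬true⇒false (λ cc →
                       <-irrefl (left-unique ac cc) (s≤s (≤ᵇ-true⁻ a≤c)))))
    from : (isRight (suc c) ∧ not (A (suc c) (suc c))) ≡ true → Ā.isRight c ≡ true
    from e with ∧-true⁻ {isRight (suc c)} e
    ... | rc , ncc with isRight-true⁻ rc
    ... | a , ac = Ā.isRight-true⁺ {a} (∧-true⁺ ac (≤ᵇ-true⁺ (≤-pred a<1+c)))
      where
      a<1+c : a < suc c
      a<1+c = ≤∧≢⇒< (proj₁ (proj₂ (valid a (suc c) ac))) (λ { refl → true≢false ac (not-true⁻ ncc) })

  isRight-1 : isRight 1 ≡ A 1 1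
  isRight-1 = true⇔true⇒≡ to isRight-true⁺
    where
    to : isRight 1 ≡ true → A 1 1 ≡ true
    to e with isRight-true⁻ e
    ... | a , a1 with valid a 1 a1
    ... | 1≤a , a≤1 , _ with ≤-antisym a≤1 1≤a
    ... | refl = a1

  private
    𝟙-not-∧-not : ∀ l d → (d ≡ true → l ≡ true) → 𝟙 (not (l ∧ not d)) ≡ 𝟙 (not l) + 𝟙 d
    𝟙-not-∧-not true true _ = refl
    𝟙-not-∧-not true false _ = refl
    𝟙-not-∧-not false true d⇒l = ⊥-elim (true≢false (d⇒l refl) refl)
    𝟙-not-∧-not false false _ = refl

    𝟙-not-+-𝟙 : ∀ d → 𝟙 (not d) + 𝟙 d ≡ 1
    𝟙-not-+-𝟙 true = refl
    𝟙-not-+-𝟙 false = refl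

  nonLeft-bar : ∀ x → Ā.nonLeft x ≡ nonLeft x + σ x
  nonLeft-bar zero = refl
  nonLeft-bar (suc x) = begin
    𝟙 (not (Ā.isLeft (suc x))) + Ā.nonLeft x
      ≡⟨ cong₂ _+_ (trans (cong (𝟙 ∘ not) (isLeft-bar (suc x))) (𝟙-not-∧-not _ _ isLeft-true⁺)) (nonLeft-bar x) ⟩
    (𝟙 (not (isLeft (suc x))) + 𝟙 (A (suc x) (suc x))) + (nonLeft x + σ x)
      ≡⟨ +-interchange (𝟙 (not (isLeft (suc x)))) _ (nonLeft x) _ ⟩
    nonLeft (suc x) + σ (suc x) ∎
    where open ≡-Reasoning

  nonRight-bar : ∀ x → suc (Ā.nonRight x) ≡ nonRight (suc x) + σ (suc x)
  nonRight-bar zero = begin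
    1                                     ≡⟨ 𝟙-not-+-𝟙 (A 1 1) ⟨
    𝟙 (not (A 1 1)) + 𝟙 (A 1 1)           ≡⟨ cong (λ r → 𝟙 (not r) + 𝟙 (A 1 1)) isRight-1 ⟨
    𝟙 (not (isRight 1)) + 𝟙 (A 1 1)       ≡⟨ cong₂ _+_ (+-identityʳ (𝟙 (not (isRight 1)))) (+-identityʳ (𝟙 (A 1 1))) ⟨
    nonRight 1 + σ 1 ∎
    where open ≡-Reasoning
  nonRight-bar (suc x) = begin
    suc (𝟙 (not (Ā.isRight (suc x))) + Ā.nonRight x)
      ≡⟨ +-suc _ _ ⟨
    𝟙 (not (Ā.isRight (suc x))) + suc (Ā.nonRight x)
      ≡⟨ cong₂ _+_ (trans (cong (𝟙 ∘ not) (isRight-bar (suc x))) (𝟙-not-∧-not _ _ isRight-true⁺)) (nonRight-bar x) ⟩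
    (𝟙 (not (isRight (suc (suc x)))) + 𝟙 (A (suc (suc x)) (suc (suc x)))) + (nonRight (suc x) + σ (suc x))
      ≡⟨ +-interchange (𝟙 (not (isRight (suc (suc x))))) _ (nonRight (suc x)) _ ⟩
    nonRight (suc (suc x)) + σ (suc (suc x)) ∎
    where open ≡-Reasoning

  nonRightσ nonLeftσ : ℕ → ℕ
  nonRightσ x = nonRight x + σ x
  nonLeftσ x = nonLeft x + σ x

  diagonal-balanced : ∀ {s} → A s s ≡ true → nonRight s ≡ nonLeft s
  diagonal-balanced {s} ss = nonRight≡nonLeft s closed
    where
    closed : ∀ a b → A a b ≡ true → a ≤ s → b ≤ s
    closed a b ab a≤s with b ≤? s
    ... | yes b≤s = b≤s
    ... | no b≰s = ⊥-elim (<⇒≢ (≰⇒> b≰s) (proj₂ (incomparable s s a b ss ab a≤s (<⇒≤ (≰⇒> b≰s)))))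

  nonRight≤nonLeft-diagonal : ∀ {i s} → A s s ≡ true → i ≤ s → nonRight i ≤ nonLeft s
  nonRight≤nonLeft-diagonal ss i≤s = ≤-trans (count-mono _ i≤s) (≤-reflexive (diagonal-balanced ss))

  nonRightσ-suc : ∀ x → isRight (suc x) ≡ false → nonRightσ (suc x) ≡ suc (nonRightσ x)
  nonRightσ-suc x r rewrite count-suc-true (not ∘ isRight) x (not-true⁺ r)
    | count-suc-false (λ s → A s s) x (¬true⇒false (λ ss → true≢false (isRight-true⁺ ss) r)) = refl

  nonRightσ-suc-right : ∀ x → isRight (suc x) ≡ true → A (suc x) (suc x) ≡ false → nonRightσ (suc x) ≡ nonRightσ x
  nonRightσ-suc-right x r ss rewrite count-suc-false (not ∘ isRight) x (not-false⁺ r)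
    | count-suc-false (λ s → A s s) x ss = refl

  -- [i, j] = [a + 1, e + 1]; in hypothesis names f and g abbreviate nonRightσ and nonLeftσ
  module _ {a e : ℕ} (a<e : a < e) where

    LK⇒nonRightσ≡ : LK n A (suc a) (suc e) ≡ true →
      (nonRightσ (suc a) ≡ suc (nonLeftσ e)) × (nonRightσ (suc a) ≡ nonLeftσ (suc e)) × (nonRightσ (suc a) ≡ suc (nonRightσ a))
    LK⇒nonRightσ≡ lk with LK-true⁻ lk
    ... | _ , _ , _ , _ , ri , lj , ri≡lj = fi≡suc-ge , fi≡gj , nonRightσ-suc a ri
      where
      nonLeft-j : nonLeft (suc e) ≡ suc (nonLeft e)
      nonLeft-j = count-suc-true (not ∘ isLeft) e (not-true⁺ lj)
      no-diagonal : ∀ s → suc a < s → s ≤ suc e → A s s ≡ false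
      no-diagonal s i<s s≤j = ¬true⇒false λ ss → excluded (m≤n⇒m<n∨m≡n s≤j) ss
        where
        excluded : s < suc e ⊎ s ≡ suc e → A s s ≡ true → ⊥
        excluded (inj₂ refl) ss = true≢false (isLeft-true⁺ ss) lj
        excluded (inj₁ s≤e) ss = <-irrefl ri≡lj (begin-strict
          nonRight (suc a) ≤⟨ nonRight≤nonLeft-diagonal ss (<⇒≤ i<s) ⟩
          nonLeft s        ≤⟨ count-mono _ (≤-pred s≤e) ⟩
          nonLeft e        <⟨ n<1+n _ ⟩
          suc (nonLeft e)  ≡⟨ nonLeft-j ⟨
          nonLeft (suc e)  ∎)
          where open ≤-Reasoning
      σe≡σi : σ e ≡ σ (suc a)
      σe≡σi = count-stable _ a<e (λ s i<s s≤e → no-diagonal s i<s (m≤n⇒m≤1+n s≤e))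
      σj≡σi : σ (suc e) ≡ σ (suc a)
      σj≡σi = count-stable _ (m≤n⇒m≤1+n a<e) no-diagonal
      fi≡suc-ge : nonRightσ (suc a) ≡ suc (nonLeftσ e)
      fi≡suc-ge = cong₂ _+_ (trans ri≡lj nonLeft-j) (sym σe≡σi)
      fi≡gj : nonRightσ (suc a) ≡ nonLeftσ (suc e)
      fi≡gj = cong₂ _+_ ri≡lj (sym σj≡σi)

    nonLeftσ<nonRightσ⇒no-diagonal : nonLeftσ e < nonRightσ (suc a) → ∀ s → suc a ≤ s → s ≤ e → A s s ≡ false
    nonLeftσ<nonRightσ⇒no-diagonal ge<fi s i≤s s≤e = ¬true⇒false λ ss → <-irrefl refl (≤-trans ge<fi (+-mono-≤
      (≤-trans (nonRight≤nonLeft-diagonal ss i≤s) (count-mono _ s≤e))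
      (count-mono _ (≤-trans i≤s s≤e))))

    nonLeftσ<nonRightσ⇒σ≡ : nonLeftσ e < nonRightσ (suc a) → σ e ≡ σ (suc a)
    nonLeftσ<nonRightσ⇒σ≡ ge<fi = count-stable _ a<e (λ s i<s → nonLeftσ<nonRightσ⇒no-diagonal ge<fi s (<⇒≤ i<s))

    nonLeftσ<nonRightσ⇒nonLeft<nonRight : nonLeftσ e < nonRightσ (suc a) → nonLeft e < nonRight (suc a)
    nonLeftσ<nonRightσ⇒nonLeft<nonRight ge<fi = +-cancelʳ-≤ (σ (suc a)) _ _
      (subst (λ t → suc (nonLeft e + t) ≤ nonRightσ (suc a)) (nonLeftσ<nonRightσ⇒σ≡ ge<fi) ge<fi)

    nonRightσ≤⇒LK : suc e ≤ n → nonLeftσ e < nonRightσ (suc a) →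
      (a ≡ 0) ⊎ (nonRightσ a ≤ nonLeftσ e) → (suc e ≡ n) ⊎ (nonRightσ (suc a) ≤ nonLeftσ (suc e)) →
      LK n A (suc a) (suc e) ≡ true
    nonRightσ≤⇒LK j≤n ge<fi leftCover rightCover =
      LK-true⁺ (s≤s z≤n) (≤-trans (m≤n⇒m≤1+n a<e) j≤n) (s≤s z≤n) j≤n ri lj
        (≤-antisym ri≤lj (≤-trans (≤-reflexive nonLeft-j) le<ri))
      where
      aii : A (suc a) (suc a) ≡ false
      aii = nonLeftσ<nonRightσ⇒no-diagonal ge<fi (suc a) ≤-refl a<e
      le<ri : nonLeft e < nonRight (suc a)
      le<ri = nonLeftσ<nonRightσ⇒nonLeft<nonRight ge<fi
      ri : isRight (suc a) ≡ false
      ri = ¬true⇒false (right-endpoint leftCover)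
        where
        right-endpoint : (a ≡ 0) ⊎ (nonRightσ a ≤ nonLeftσ e) → isRight (suc a) ≢ true
        right-endpoint (inj₁ refl) r = true≢false (trans (sym isRight-1) r) aii
        right-endpoint (inj₂ fa≤ge) r = <-irrefl refl
          (≤-trans ge<fi (≤-trans (≤-reflexive (nonRightσ-suc-right a r aii)) fa≤ge))
      ajj : A (suc e) (suc e) ≡ false
      ajj = ¬true⇒false λ ss → <-irrefl refl (≤-trans le<ri (begin
        nonRight (suc a) ≤⟨ nonRight≤nonLeft-diagonal ss (m≤n⇒m≤1+n a<e) ⟩
        nonLeft (suc e)  ≡⟨ count-suc-false (not ∘ isLeft) e (not-false⁺ (isLeft-true⁺ ss)) ⟩
        nonLeft e        ∎))
        where open ≤-Reasoning
      σj≡σi : σ (suc e) ≡ σ (suc a)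
      σj≡σi = trans (count-suc-false _ e ajj) (nonLeftσ<nonRightσ⇒σ≡ ge<fi)
      ri≤lj : nonRight (suc a) ≤ nonLeft (suc e)
      ri≤lj = inside rightCover
        where
        inside : (suc e ≡ n) ⊎ (nonRightσ (suc a) ≤ nonLeftσ (suc e)) → nonRight (suc a) ≤ nonLeft (suc e)
        inside (inj₂ fi≤gj) =
          +-cancelʳ-≤ (σ (suc a)) _ _ (subst (λ t → nonRightσ (suc a) ≤ nonLeft (suc e) + t) σj≡σi fi≤gj)
        inside (inj₁ refl) = ≤-trans (count-mono _ (≤-trans (m≤n⇒m≤1+n a<e) j≤n))
                               (≤-reflexive (nonRight≡nonLeft (suc e) (λ a b ab _ → proj₂ (proj₂ (valid a b ab)))))
      lj : isLeft (suc e) ≡ false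
      lj = ¬true⇒false λ l → <-irrefl refl (≤-trans le<ri (≤-trans ri≤lj
             (≤-reflexive (count-suc-false (not ∘ isLeft) e (not-false⁺ l)))))
      nonLeft-j : nonLeft (suc e) ≡ suc (nonLeft e)
      nonLeft-j = count-suc-true (not ∘ isLeft) e (not-true⁺ lj)

  LK⇔barCounts : ∀ {a e} → a < e → suc e ≤ n → (LK n A (suc a) (suc e) ≡ true) ⇔ Ā.MaximalOutsideLK a e
  LK⇔barCounts {a} {e} a<e j≤n = mk⇔ to from
    where
    to : LK n A (suc a) (suc e) ≡ true → Ā.MaximalOutsideLK a e
    to lk with LK⇒nonRightσ≡ a<e lk
    ... | fi≡1+ge , fi≡gj , fi≡1+fa =
      ≤-reflexive ge≡r , left a fi≡1+ge fi≡1+fa ,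
      inj₂ (≤-reflexive (trans (nonRight-bar a) (trans fi≡gj (sym (nonLeft-bar (suc e))))))
      where
      ge≡r : Ā.nonLeft e ≡ Ā.nonRight a
      ge≡r = suc-injective (trans (cong suc (nonLeft-bar e)) (trans (sym fi≡1+ge) (sym (nonRight-bar a))))
      left : ∀ a → nonRightσ (suc a) ≡ suc (nonLeftσ e) → nonRightσ (suc a) ≡ suc (nonRightσ a) →
        (a ≡ 0) ⊎ (Ā.nonRight (a ∸ 1) < Ā.nonLeft e)
      left zero _ _ = inj₁ refl
      left (suc a) fi≡1+ge fi≡1+fa =
        inj₂ (≤-reflexive (trans (nonRight-bar a) (trans (suc-injective (trans (sym fi≡1+fa) fi≡1+ge)) (sym (nonLeft-bar e)))))
    from : Ā.MaximalOutsideLK a e → LK n A (suc a) (suc e) ≡ true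
    from (ge≤r , leftCover , rightCover) = nonRightσ≤⇒LK a<e j≤n
      (subst₂ _≤_ (cong suc (nonLeft-bar e)) (nonRight-bar a) (s≤s ge≤r)) (left a leftCover) (right rightCover)
      where
      left : ∀ a → (a ≡ 0) ⊎ (Ā.nonRight (a ∸ 1) < Ā.nonLeft e) → (a ≡ 0) ⊎ (nonRightσ a ≤ nonLeftσ e)
      left zero _ = inj₁ refl
      left (suc a) (inj₂ r<ge) = inj₂ (subst₂ _≤_ (nonRight-bar a) (nonLeft-bar e) r<ge)
      right : (e ≡ m) ⊎ (Ā.nonRight a < Ā.nonLeft (suc e)) → (suc e ≡ n) ⊎ (nonRightσ (suc a) ≤ nonLeftσ (suc e))
      right (inj₁ e≡m) = inj₁ (≡∸1⇒suc≡ j≤n e≡m)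
      right (inj₂ r<gj) = inj₂ (subst₂ _≤_ (nonRight-bar a) (nonLeft-bar (suc e)) r<gj)

module RowInverseLK (m : ℕ) (B : ASet) (antichainB : IsAntichain m B) (C : ASet) (antichainC : IsAntichain m C)
                    (row≡LK : ∀ a b → rowA m C a b ≡ LK m B a b) where

  open Rowmotion m C antichainC
  open LKUpSet m B antichainB
  open Antichain m B antichainB using (nonLeft; nonRight)

  private
    toLK : ∀ {a b} → AboveRow a b → AboveLK a b
    toLK (c , d , r , a≤c , d≤b) = c , d , trans (sym (row≡LK c d)) r , a≤c , d≤b

    fromLK : ∀ {a b} → AboveLK a b → AboveRow a b
    fromLK (c , d , l , a≤c , d≤b) = c , d , trans (row≡LK c d) l , a≤c , d≤b

  C⇔maximalOutsideLK : ∀ {a b} → suc a ≤ b → b ≤ m → (C (suc a) b ≡ true) ⇔ MaximalOutsideLK a b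
  C⇔maximalOutsideLK {a} {b} i≤b b≤m = mk⇔ (counts ∘ C⇒maximalOutside) (maximalOutside⇒C ∘ maximal)
    where
    counts : MaximalOutside (suc a) b → MaximalOutsideLK a b
    counts (_ , notAbove , leftCover , rightCover) =
      ≮⇒≥ (λ r<l → notAbove (fromLK (<⇒aboveLK (s≤s z≤n) b≤m r<l))) , left a leftCover , right rightCover
      where
      left : ∀ a → (suc a ≡ 1) ⊎ AboveRow a b → (a ≡ 0) ⊎ (nonRight (a ∸ 1) < nonLeft b)
      left zero _ = inj₁ refl
      left (suc a) (inj₂ above) = inj₂ (aboveLK⇒< (s≤s z≤n) (toLK above))
      right : (b ≡ m) ⊎ AboveRow (suc a) (suc b) → (b ≡ m) ⊎ (nonRight a < nonLeft (suc b))
      right (inj₁ b≡m) = inj₁ b≡m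
      right (inj₂ above) = inj₂ (aboveLK⇒< (s≤s z≤n) (toLK above))
    maximal : MaximalOutsideLK a b → MaximalOutside (suc a) b
    maximal (l≤r , leftCover , rightCover) =
      (s≤s z≤n , i≤b , b≤m) , (λ above → ≤⇒≯ l≤r (aboveLK⇒< (s≤s z≤n) (toLK above))) ,
      left a leftCover , right (m≤n⇒m<n∨m≡n b≤m) rightCover
      where
      left : ∀ a → (a ≡ 0) ⊎ (nonRight (a ∸ 1) < nonLeft b) → (suc a ≡ 1) ⊎ AboveRow a b
      left zero _ = inj₁ refl
      left (suc a) (inj₂ r<l) = inj₂ (fromLK (<⇒aboveLK (s≤s z≤n) b≤m r<l))
      right : (b < m) ⊎ (b ≡ m) → (b ≡ m) ⊎ (nonRight a < nonLeft (suc b)) → (b ≡ m) ⊎ AboveRow (suc a) (suc b)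
      right (inj₂ b≡m) _ = inj₁ b≡m
      right (inj₁ _) (inj₁ b≡m) = inj₁ b≡m
      right (inj₁ b<m) (inj₂ r<l) = inj₂ (fromLK (<⇒aboveLK (s≤s z≤n) b<m r<l))

lemma3p1 : (n : ℕ) → 1 ≤ n → (A : ASet) → IsAntichain n A →
    ((i : ℕ) → 1 ≤ i → i ≤ n →
      ((LK n A i i ≡ true) ⇔ (tau0 n A i i ≡ true)) ×
      ((LK n A i i ≡ true) ⇔ (¬ Σ ℕ (λ k → Σ ℕ (λ l → (A k l ≡ true) × (k ≤ i) × (i ≤ l)))))) ×
    ((i j : ℕ) → 1 ≤ i → i < j → j ≤ n →
      (C : ASet) → IsAntichain (n ∸ 1) C →
      ((a b : ℕ) → rowA (n ∸ 1) C a b ≡ LK (n ∸ 1) (bar A) a b) →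
      ((LK n A i j ≡ true) ⇔ (C i (j ∸ 1) ≡ true)))
lemma3p1 n _ A antichain = diagonal , offDiagonal
  where
  open Bar n A antichain using (bar-antichain)

  diagonal : (i : ℕ) → 1 ≤ i → i ≤ n →
    ((LK n A i i ≡ true) ⇔ (tau0 n A i i ≡ true)) × ((LK n A i i ≡ true) ⇔ (¬ Antichain.Covered n A antichain i))
  diagonal i 1≤i i≤n = ⇔-trans uncovered (⇔-sym (Toggles.tau0-diagonal n A antichain 1≤i i≤n)) , uncovered
    where uncovered = Antichain.LK-diagonal n A antichain 1≤i i≤n

  offDiagonal : (i j : ℕ) → 1 ≤ i → i < j → j ≤ n → (C : ASet) → IsAntichain (n ∸ 1) C →
    ((a b : ℕ) → rowA (n ∸ 1) C a b ≡ LK (n ∸ 1) (bar A) a b) → (LK n A i j ≡ true) ⇔ (C i (j ∸ 1) ≡ true)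
  offDiagonal (suc a) (suc e) _ (s≤s a<e) j≤n C antichainC row≡LK =
    ⇔-trans (Bar.LK⇔barCounts n A antichain a<e j≤n)
            (⇔-sym (RowInverseLK.C⇔maximalOutsideLK (n ∸ 1) (bar A) bar-antichain C antichainC row≡LK a<e (<⇒≤∸1 j≤n)))
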